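{- Let $k,l\in\mathbb N$ and let $t_1,\dots,t_l$ be terms over the symbols $\{h_1,\dots,h_k\}$ in the signature $\{\wedge,\vee,{}^d\}$ (binary $\wedge,\vee$ and unary ${}^d$). For a $k$-tuple $(h_1,\dots,h_k)$ of $n$-ary Boolean operations, let $t_j(h_1,\dots,h_k):\{0,1\}^n\to\{0,1\}$ be obtained by substituting $h_i$ for the symbol $h_i$ and evaluating. Then the collection $\xi=(\xi^{(n)}:\mathcal I_k^{(n)}\to\mathcal I_l^{(n)})_n$ given by $\xi(h_1,\dots,h_k)=(t_1(h_1,\dots,h_k),\dots,t_l(h_1,\dots,h_k))$ is a (well-defined) minion homomorphism $\mathcal I_k\to\mathcal I_l$.
   Context: For Boolean operations $f,g:\{0,1\}^n\to\{0,1\}$: $(f\wedge g)(\mathbf a)=\min(f(\mathbf a),g(\mathbf a))$, $(f\vee g)(\mathbf a)=\max(f(\mathbf a),g(\mathbf a))$, $f^d(\mathbf a)=1-f(\overline{\mathbf a})$ with $\overline{\mathbf a}$ the coordinatewise negation. $\mathcal I_k$ is the set of all $k$-tuples of $n$-ary idempotent Boolean operations ($f(a,\dots,a)=a$), $n\in\mathbb N$; $\mathcal I_k^{(n)}$ its $n$-ary members. A minion homomorphism is an arity-preserving map $\xi$ with $\xi(\mathbf h^{(\alpha)})=\xi(\mathbf h)^{(\alpha)}$ for all $\alpha:[n]\to[m]$, where minors are taken componentwise: $h^{(\alpha)}(a_1,\dots,a_m)=h(a_{\alpha(1)},\dots,a_{\alpha(n)})$. -}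

module Defs where

open import Data.Nat using (ℕ)
open import Data.Fin using (Fin)
open import Data.Bool using (Bool; true; false; not; _∧_; _∨_)
open import Data.Product using (Σ; _×_; _,_; proj₁)
open import Relation.Binary.PropositionalEquality using (_≡_)

Op : ℕ → Set
Op n = (Fin n → Bool) → Bool

Tuple : ℕ → ℕ → Set
Tuple k n = Fin k → Op n

IsIdempotent : ∀ {n} → Op n → Set
IsIdempotent {n} f = ∀ (a : Bool) → f (λ _ → a) ≡ a

I : ℕ → ℕ → Set
I k n = Σ (Tuple k n) (λ h → ∀ i → IsIdempotent (h i))

minorOp : ∀ {n m} → (Fin n → Fin m) → Op n → Op m
minorOp α f a = f (λ i → a (α i))

minorTuple : ∀ {k n m} → (Fin n → Fin m) → Tuple k n → Tuple k m
minorTuple α h j = minorOp α (h j)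

minorI : ∀ {k n m} → (Fin n → Fin m) → I k n → I k m
minorI α (h , p) = minorTuple α h , λ j a → p j a

-- equality of tuples of operations (extensional, since operations are functions)
_≈T_ : ∀ {k n} → Tuple k n → Tuple k n → Set
_≈T_ {k} {n} h g = ∀ (j : Fin k) (a : Fin n → Bool) → h j a ≡ g j a

IsMinionHom : ∀ {k l} → (ξ : ∀ n → I k n → I l n) → Set
IsMinionHom {k} {l} ξ =
  ∀ (n m : ℕ) (α : Fin n → Fin m) (h : I k n) →
    proj₁ (ξ m (minorI α h)) ≈T minorTuple α (proj₁ (ξ n h))

data Term (k : ℕ) : Set where
  var  : Fin k → Term k
  _∧ₜ_ : Term k → Term k → Term k
  _∨ₜ_ : Term k → Term k → Term k
  dual : Term k → Term k

dualOp : ∀ {n} → Op n → Op n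
dualOp f a = not (f (λ i → not (a i)))

eval : ∀ {k n} → Term k → Tuple k n → Op n
eval (var i) h = h i
eval (s ∧ₜ t) h a = eval s h a ∧ eval t h a
eval (s ∨ₜ t) h a = eval s h a ∨ eval t h a
eval (dual t) h = dualOp (eval t h)

evalTuple : ∀ {k l n} → (Fin l → Term k) → Tuple k n → Tuple l n
evalTuple ts h j = eval (ts j) h

{-# OPTIONS --safe #-}
module Submission where

open import Defs
open import Data.Nat using (ℕ)
open import Data.Fin using (Fin)
open import Data.Product using (Σ; _×_; proj₁; _,_)
open import Data.Bool using (not; _∧_; _∨_)
open import Data.Bool.Properties using (∧-idem; ∨-idem; not-involutive)
open import Relation.Binary.PropositionalEquality using (_≡_; refl; trans; cong; cong₂)

-- ∧ and ∨ act pointwise and ^d negates both the arguments and the value, so each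
-- preserves idempotence and commutes with reindexing the arguments by a minor;
-- induction on terms transfers both properties to every term.

eval-idempotent : ∀ {k n} (t : Term k) (h : Tuple k n) →
  (∀ i → IsIdempotent (h i)) → IsIdempotent (eval t h)
eval-idempotent (var i)  h idem a = idem i a
eval-idempotent (s ∧ₜ t) h idem a =
  trans (cong₂ _∧_ (eval-idempotent s h idem a) (eval-idempotent t h idem a)) (∧-idem a)
eval-idempotent (s ∨ₜ t) h idem a =
  trans (cong₂ _∨_ (eval-idempotent s h idem a) (eval-idempotent t h idem a)) (∨-idem a)
eval-idempotent (dual t) h idem a =
  trans (cong not (eval-idempotent t h idem (not a))) (not-involutive a)

eval-minorTuple : ∀ {k n m} (α : Fin n → Fin m) (t : Term k) (h : Tuple k n) →
  ∀ a → eval t (minorTuple α h) a ≡ minorOp α (eval t h) a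
eval-minorTuple α (var i)  h a = refl
eval-minorTuple α (s ∧ₜ t) h a = cong₂ _∧_ (eval-minorTuple α s h a) (eval-minorTuple α t h a)
eval-minorTuple α (s ∨ₜ t) h a = cong₂ _∨_ (eval-minorTuple α s h a) (eval-minorTuple α t h a)
eval-minorTuple α (dual t) h a = cong not (eval-minorTuple α t h (λ i → not (a i)))

termMap : ∀ {k l} → (Fin l → Term k) → ∀ n → I k n → I l n
termMap ts n (h , idem) = evalTuple ts h , λ j → eval-idempotent (ts j) h idem

termMap-isMinionHom : ∀ {k l} (ts : Fin l → Term k) → IsMinionHom (termMap ts)
termMap-isMinionHom ts n m α (h , _) j = eval-minorTuple α (ts j) h

lemma4p9 : (k l : ℕ) (ts : Fin l → Term k) →
    Σ (∀ n → I k n → I l n) (λ ξ →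
      (∀ n (h : I k n) → proj₁ (ξ n h) ≈T evalTuple ts (proj₁ h))
      × IsMinionHom ξ)
lemma4p9 k l ts = termMap ts , (λ n h j a → refl) , termMap-isMinionHom ts
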